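{- Let $(G,\circ)$ be a finite abelian group with identity $1$, and let $H\subseteq G$ be a cyclic subgroup of order $k\ge 2$ generated by $g$, so $H=\{g,g^2,\dots,g^k\}$. Put $d=\lceil \sqrt{k}\,\rceil$ and $$A=\{g,g^2,\dots,g^d\}\cup\{g^d,g^{2d},\dots,g^{(d-1)d},g^{d^2}\}.$$ Then $|A|<2d$, $A\circ A^{ -1}=H$, and $$\nu(A)\le \frac{|G|}{k}<\frac{16\,|G|}{|A|^2}.$$
   Context: For subsets $A,B$ of a finite abelian group $(G,\circ)$, the product set is $A\circ B=\{a\circ b: a\in A, b\in B\}$ and the ratio set is $A\circ A^{ -1}=\{a\circ b^{ -1}: a,b\in A\}$. A set $B\subseteq G$ is called an $A$-packing set if $|A\circ B|=|A|\,|B|$. For nonempty $A\subseteq G$, $\nu(A)$ denotes the maximal size of an $A$-packing set: $\nu(A)=\max\{|B|: B\subseteq G,\ |A\circ B|=|A||B|\}$. -}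

module Defs where

open import Data.Bool using (Bool; true; false; _∧_; _∨_)
open import Data.Nat using (ℕ; zero; suc; _*_; _≤?_; _⊔_; _≡ᵇ_)
open import Data.Fin using (Fin; _≟_)
open import Data.Fin.Subset using (Subset; ∣_∣)
open import Data.Vec using (Vec; []; _∷_; tabulate; lookup)
open import Data.List using (List; []; _∷_; map; _++_; allFin; upTo; foldr)
open import Data.Bool.ListAction using (any)
open import Relation.Nullary.Decidable using (does; _because_)

-- A finite group of order n is represented (up to isomorphism) with carrier Fin n;
-- subsets of G are 'Subset n' (Vec Bool n), with cardinality ∣_∣.

module _ {n : ℕ} (_∙_ : Fin n → Fin n → Fin n) (ε : Fin n) (_⁻¹ : Fin n → Fin n) where

  pow : Fin n → ℕ → Fin n
  pow g zero    = ε
  pow g (suc m) = g ∙ pow g m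

  productSet : Subset n → Subset n → Subset n
  productSet A B = tabulate λ x →
    any (λ a → any (λ b → lookup A a ∧ lookup B b ∧ does (x ≟ (a ∙ b))) (allFin n)) (allFin n)

  ratioSet : Subset n → Subset n
  ratioSet A = tabulate λ x →
    any (λ a → any (λ b → lookup A a ∧ lookup A b ∧ does (x ≟ (a ∙ (b ⁻¹)))) (allFin n)) (allFin n)

  cyclicSet : Fin n → ℕ → Subset n
  cyclicSet g k = tabulate λ x → any (λ i → does (x ≟ pow g (suc i))) (upTo k)

  setA : Fin n → ℕ → Subset n
  setA g d = tabulate λ x →
    any (λ i → does (x ≟ pow g (suc i))) (upTo d)
    ∨ any (λ j → does (x ≟ pow g (suc j * d))) (upTo d)

  isPacking : Subset n → Subset n → Bool
  isPacking A B = ∣ productSet A B ∣ ≡ᵇ (∣ A ∣ * ∣ B ∣)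

allSubsets : ∀ n → List (Subset n)
allSubsets zero    = [] ∷ []
allSubsets (suc n) = map (true ∷_) (allSubsets n) ++ map (false ∷_) (allSubsets n)

-- ν(A) = max { |B| : B ⊆ G , |A ∘ B| = |A| |B| }  (the empty set is always a packing set)
ν : {n : ℕ} (_∙_ : Fin n → Fin n → Fin n) (ε : Fin n) (_⁻¹ : Fin n → Fin n) → Subset n → ℕ
ν {n} _∙_ ε _⁻¹ A =
  foldr _⊔_ 0 (map (λ B → if' (isPacking _∙_ ε _⁻¹ A B) ∣ B ∣) (allSubsets n))
  where
  if' : Bool → ℕ → ℕ
  if' true  m = m
  if' false _ = 0

-- ⌈ √k ⌉ : the least d with k ≤ d * d (search with fuel k; d = k always works for k ≥ 1)
ceilSqrtAux : ℕ → ℕ → ℕ → ℕ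
ceilSqrtAux k d zero = d
ceilSqrtAux k d (suc fuel) with k ≤? d * d
... | true  because _ = d
... | false because _ = ceilSqrtAux k (suc d) fuel

ceilSqrt : ℕ → ℕ
ceilSqrt k = ceilSqrtAux k 0 k

-- A consists of the baby steps g, …, gᵈ and the giant steps gᵈ, g²ᵈ, …, g^(d·d); since gᵈ is listed
-- twice, |A| < 2d.  Every r < k ≤ d² is a giant step minus a baby step, r = (j + 1)d − (i + 1), so
-- A ∘ A⁻¹ contains H; conversely every ratio of powers of g lies in H.  If B is A-packing then
-- |A ∘ B| = |A||B| forces a ∙ b = a′ ∙ b′ ⇒ b = b′ on A × B; writing h h′⁻¹ = a a′⁻¹ for h, h′ ∈ H,
-- the translates b H (b ∈ B) are pairwise disjoint, so ν(A) k ≤ |G|.  Finally d ≥ 2 and (d − 1)² < k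
-- give |A|² < (2d)² ≤ 16 (d − 1)² < 16 k.

module Submission where

open import Defs
open import Data.Nat using (ℕ; suc; _*_; _≤_; _<_)
open import Data.Fin using (Fin)
open import Data.Fin.Subset using (∣_∣)
open import Data.Product using (_×_)
open import Algebra.Structures using (IsAbelianGroup)
open import Relation.Binary.PropositionalEquality using (_≡_; _≢_)

open import Level using (0ℓ)
open import Algebra.Bundles using (AbelianGroup; Group)
open import Data.Bool using (Bool; true; false; T; _∧_)
open import Data.Bool.Properties using (T-≡; T-∧; T-∨)
open import Data.Bool.ListAction using (any)
open import Data.Empty using (⊥-elim)
open import Data.Fin using (zero; suc; _≟_)
open import Data.Fin.Properties using (suc-injective)
open import Data.Fin.Subset using (Subset; _∈_)
open import Data.Fin.Subset.Properties using (⊆-antisym)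
open import Data.List using (List; []; _∷_; _++_; map; length; upTo; applyUpTo; allFin; cartesianProduct)
open import Data.List.Properties using (length-++; length-++-sucʳ; length-map; length-applyUpTo; length-upTo; length-tabulate)
open import Data.List.Membership.Propositional using (find; lose) renaming (_∈_ to _∈ₗ_)
open import Data.List.Membership.Propositional.Properties
  using (∈-∃++; ∈-++⁺ˡ; ∈-++⁺ʳ; ∈-++⁻; ∈-map⁺; ∈-map⁻; ∈-upTo⁺; ∈-applyUpTo⁻; ∈-allFin;
         ∈-cartesianProduct⁺; ∈-cartesianProduct⁻; foldr-selective)
open import Data.List.Relation.Binary.Subset.Propositional using () renaming (_⊆_ to _⊆ₗ_)
open import Data.List.Relation.Unary.All as All using (All)
import Data.List.Relation.Unary.All.Properties as All
open import Data.List.Relation.Unary.AllPairs using ([]; _∷_)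
open import Data.List.Relation.Unary.Any using (here; there)
open import Data.List.Relation.Unary.Any.Properties using (any⁺; any⁻)
open import Data.List.Relation.Unary.Unique.Propositional using (Unique)
import Data.List.Relation.Unary.Unique.Propositional.Properties as Unique
open import Data.Nat using (zero; _+_; _∸_; z≤n; s≤s; s≤s⁻¹; _≤?_; NonZero; >-nonZero; >-nonZero⁻¹)
open import Data.Nat.DivMod using (_%_; _/_; m≡m%n+[m/n]*n; m%n<n; m<n*o⇒m/o<n)
open import Data.Nat.Properties
  using (≤-reflexive; ≤-trans; <-trans; <-≤-trans; <⇒≤; <⇒≢; ≰⇒>; m≤n⇒m<n∨m≡n; n<1+n; m≤m+n; m≤n+m;
         m≤m*n; m∸n≤m; m∸n+n≡m; m+[n∸m]≡n; m<n⇒0<n∸m; m<n+o⇒m∸n<o; ⊔-sel; ≡ᵇ⇒≡; suc-pred;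
         +-comm; +-assoc; +-suc; +-identityʳ; *-suc; *-identityˡ; *-mono-<; *-monoʳ-<; *-monoʳ-≤;
         module ≤-Reasoning)
open import Data.Nat.Tactic.RingSolver using (solve-∀)
open import Data.Product using (∃-syntax; _,_; proj₁; proj₂; uncurry)
open import Data.Sum as Sum using (_⊎_; inj₁; inj₂)
open import Data.Unit using (tt)
open import Data.Vec using ([]; _∷_; here; there; tabulate; lookup)
open import Data.Vec.Properties using (lookup∘tabulate; []=⇒lookup; lookup⇒[]=)
open import Function using (_∘_; _∋_; Equivalence)
open import Relation.Binary.Definitions using (DecidableEquality)
open import Relation.Binary.PropositionalEquality using (refl; sym; trans; cong; cong₂; subst; module ≡-Reasoning)
open import Relation.Nullary using (¬_; Dec; yes; no; does; contradiction)

-- Counting with duplicate-free lists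

module _ {X : Set} where

  ∈-++-∷⁻ : ∀ p {q : List X} {y z} → z ∈ₗ p ++ y ∷ q → z ≡ y ⊎ z ∈ₗ p ++ q
  ∈-++-∷⁻ []      (here z≡y)  = inj₁ z≡y
  ∈-++-∷⁻ []      (there z∈q) = inj₂ z∈q
  ∈-++-∷⁻ (x ∷ p) (here z≡x)  = inj₂ (here z≡x)
  ∈-++-∷⁻ (x ∷ p) (there z∈)  = Sum.map₂ there (∈-++-∷⁻ p z∈)

  Unique-⊆⇒length≤ : ∀ {xs ys : List X} → Unique xs → xs ⊆ₗ ys → length xs ≤ length ys
  Unique-⊆⇒length≤ {[]}     _          _       = z≤n
  Unique-⊆⇒length≤ {x ∷ xs} (x∉xs ∷ xs!) x∷xs⊆ys with p , q , refl ← ∈-∃++ (x∷xs⊆ys (here refl)) =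
    ≤-trans (s≤s (Unique-⊆⇒length≤ xs! xs⊆p++q)) (≤-reflexive (sym (length-++-sucʳ p x q)))
    where
    xs⊆p++q : xs ⊆ₗ p ++ q
    xs⊆p++q z∈xs with ∈-++-∷⁻ p (x∷xs⊆ys (there z∈xs))
    ... | inj₁ refl = ⊥-elim (All.lookup x∉xs z∈xs refl)
    ... | inj₂ z∈   = z∈

  Unique-++⇒disjoint : ∀ xs {ys : List X} {x} → Unique (xs ++ ys) → x ∈ₗ xs → ¬ x ∈ₗ ys
  Unique-++⇒disjoint (x ∷ xs) (x∉ ∷ _)  (here refl) x∈ys = All.lookup x∉ (∈-++⁺ʳ xs x∈ys) refl
  Unique-++⇒disjoint (_ ∷ xs) (_ ∷ xs!) (there x∈)  x∈ys = Unique-++⇒disjoint xs xs! x∈ x∈ys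

module _ {X : Set} (_≟ₓ_ : DecidableEquality X) where
  open import Data.List.Membership.DecPropositional _≟ₓ_ using (_∈?_)

  ¬Unique⇒duplicate : ∀ {ys : List X} → ¬ Unique ys →
                      ∃[ p ] ∃[ y ] ∃[ q ] ys ≡ p ++ y ∷ q × y ∈ₗ p ++ q
  ¬Unique⇒duplicate {[]}     ¬ys! = contradiction [] ¬ys!
  ¬Unique⇒duplicate {y ∷ ys} ¬ys! with y ∈? ys
  ... | yes y∈ys = [] , y , ys , refl , y∈ys
  ... | no  y∉ys with p , z , q , refl , z∈ ← ¬Unique⇒duplicate (¬ys! ∘ (All.¬Any⇒All¬ ys y∉ys ∷_)) =
    y ∷ p , z , q , refl , there z∈

  Unique-⊆-¬Unique⇒length< : ∀ {xs ys : List X} → Unique xs → xs ⊆ₗ ys → ¬ Unique ys →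
                             length xs < length ys
  Unique-⊆-¬Unique⇒length< {xs} xs! xs⊆ys ¬ys! with p , y , q , refl , y∈ ← ¬Unique⇒duplicate ¬ys! =
    ≤-trans (s≤s (Unique-⊆⇒length≤ xs! xs⊆p++q)) (≤-reflexive (sym (length-++-sucʳ p y q)))
    where
    xs⊆p++q : xs ⊆ₗ p ++ q
    xs⊆p++q z∈xs with ∈-++-∷⁻ p (xs⊆ys z∈xs)
    ... | inj₁ refl = y∈
    ... | inj₂ z∈   = z∈

module _ {X Y : Set} (f : X → Y) where

  Unique-map⁺ : ∀ {xs} → (∀ {x y} → x ∈ₗ xs → y ∈ₗ xs → f x ≡ f y → x ≡ y) →
                Unique xs → Unique (map f xs)
  Unique-map⁺ inj []          = []
  Unique-map⁺ inj (x∉xs ∷ xs!) =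
    All.map⁺ (All.tabulate λ y∈ fx≡fy → All.lookup x∉xs y∈ (inj (here refl) (there y∈) fx≡fy))
    ∷ Unique-map⁺ (λ x∈ y∈ → inj (there x∈) (there y∈)) xs!

  Unique-map⇒injectiveOn : ∀ {xs} → Unique (map f xs) →
                           ∀ {x y} → x ∈ₗ xs → y ∈ₗ xs → f x ≡ f y → x ≡ y
  Unique-map⇒injectiveOn _          (here refl) (here refl) _     = refl
  Unique-map⇒injectiveOn (fx∉ ∷ _)  (here refl) (there y∈)  fx≡fy = ⊥-elim (All.lookup fx∉ (∈-map⁺ f y∈) fx≡fy)
  Unique-map⇒injectiveOn (fy∉ ∷ _)  (there x∈)  (here refl) fx≡fy = ⊥-elim (All.lookup fy∉ (∈-map⁺ f x∈) (sym fx≡fy))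
  Unique-map⇒injectiveOn (_ ∷ fxs!) (there x∈)  (there y∈)        = Unique-map⇒injectiveOn fxs! x∈ y∈

length-cartesianProduct : ∀ {X Y : Set} (xs : List X) (ys : List Y) →
                          length (cartesianProduct xs ys) ≡ length xs * length ys
length-cartesianProduct []       ys = refl
length-cartesianProduct (x ∷ xs) ys = trans (length-++ (map (x ,_) ys))
  (cong₂ _+_ (length-map (x ,_) ys) (length-cartesianProduct xs ys))

-- Subsets of Fin n and boolean membership tests

elements : ∀ {n} → Subset n → List (Fin n)
elements []          = []
elements (true ∷ p)  = zero ∷ map suc (elements p)
elements (false ∷ p) = map suc (elements p)

length-elements : ∀ {n} (p : Subset n) → length (elements p) ≡ ∣ p ∣
length-elements []          = refl
length-elements (true ∷ p)  = cong suc (trans (length-map suc (elements p)) (length-elements p))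
length-elements (false ∷ p) = trans (length-map suc (elements p)) (length-elements p)

Unique-elements : ∀ {n} (p : Subset n) → Unique (elements p)
Unique-elements []          = []
Unique-elements (true ∷ p)  =
  All.map⁺ (All.universal (λ _ ()) (elements p)) ∷ Unique.map⁺ suc-injective (Unique-elements p)
Unique-elements (false ∷ p) = Unique.map⁺ suc-injective (Unique-elements p)

∈-elements⁺ : ∀ {n} {p : Subset n} {x} → x ∈ p → x ∈ₗ elements p
∈-elements⁺ {p = true ∷ p}  here        = here refl
∈-elements⁺ {p = true ∷ p}  (there x∈p) = there (∈-map⁺ suc (∈-elements⁺ x∈p))
∈-elements⁺ {p = false ∷ p} (there x∈p) = ∈-map⁺ suc (∈-elements⁺ x∈p)

∈-elements⁻ : ∀ {n} {p : Subset n} {x} → x ∈ₗ elements p → x ∈ p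
∈-elements⁻ {p = true ∷ p}  (here refl) = here
∈-elements⁻ {p = true ∷ p}  (there x∈)  with y , y∈ , refl ← ∈-map⁻ suc x∈ = there (∈-elements⁻ y∈)
∈-elements⁻ {p = false ∷ p} x∈          with y , y∈ , refl ← ∈-map⁻ suc x∈ = there (∈-elements⁻ y∈)

module _ {n : ℕ} {p : Subset n} {xs : List (Fin n)} (p⊆xs : ∀ {x} → x ∈ p → x ∈ₗ xs) where

  ∣p∣<length : ¬ Unique xs → ∣ p ∣ < length xs
  ∣p∣<length ¬xs! = subst (_< length xs) (length-elements p)
    (Unique-⊆-¬Unique⇒length< _≟_ (Unique-elements p) (p⊆xs ∘ ∈-elements⁻) ¬xs!)

T-does⁻ : ∀ {P : Set} (P? : Dec P) → T (does P?) → P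
T-does⁻ (yes p) _ = p

T-does⁺ : ∀ {P : Set} (P? : Dec P) → P → T (does P?)
T-does⁺ (yes _)  _ = tt
T-does⁺ (no ¬p)  p = ¬p p

T-any⁻ : ∀ {X : Set} (p : X → Bool) xs → T (any p xs) → ∃[ x ] x ∈ₗ xs × T (p x)
T-any⁻ p xs = find ∘ any⁻ p xs

T-any⁺ : ∀ {X : Set} (p : X → Bool) {xs x} → x ∈ₗ xs → T (p x) → T (any p xs)
T-any⁺ p x∈ px = any⁺ p (lose x∈ px)

module _ {n : ℕ} where

  T-lookup⇒∈ : ∀ {p : Subset n} {x} → T (lookup p x) → x ∈ p
  T-lookup⇒∈ {p} {x} t = lookup⇒[]= x p (Equivalence.to T-≡ t)

  ∈⇒T-lookup : ∀ {p : Subset n} {x} → x ∈ p → T (lookup p x)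
  ∈⇒T-lookup x∈p = Equivalence.from T-≡ ([]=⇒lookup x∈p)

  ∈-tabulate⁻ : ∀ {f : Fin n → Bool} {x} → x ∈ tabulate f → T (f x)
  ∈-tabulate⁻ {f} {x} x∈ = subst T (lookup∘tabulate f x) (∈⇒T-lookup x∈)

  ∈-tabulate⁺ : ∀ {f : Fin n → Bool} {x} → T (f x) → x ∈ tabulate f
  ∈-tabulate⁺ {f} {x} t = T-lookup⇒∈ (subst T (sym (lookup∘tabulate f x)) t)

  occurs : ∀ {I : Set} → (I → Fin n) → List I → Fin n → Bool
  occurs f is x = any (λ i → does (x ≟ f i)) is

  T-occurs⁻ : ∀ {I : Set} (f : I → Fin n) is {x} → T (occurs f is x) → ∃[ i ] i ∈ₗ is × x ≡ f i
  T-occurs⁻ f is {x} t =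
    let i , i∈ , x≡fi = T-any⁻ _ is t in i , i∈ , T-does⁻ (x ≟ f i) x≡fi

  T-occurs⁺ : ∀ {I : Set} (f : I → Fin n) {is x i} → i ∈ₗ is → x ≡ f i → T (occurs f is x)
  T-occurs⁺ f {x = x} {i} i∈ x≡fi = T-any⁺ _ i∈ (T-does⁺ (x ≟ f i) x≡fi)

  -- { a ⊕ b : a ∈ A , b ∈ B }: productSet A B is image₂ _∙_ A B, and ratioSet A is image₂ _//_ A A.
  image₂ : (Fin n → Fin n → Fin n) → Subset n → Subset n → Subset n
  image₂ _⊕_ A B = tabulate λ x →
    any (λ a → any (λ b → lookup A a ∧ lookup B b ∧ does (x ≟ (a ⊕ b))) (allFin n)) (allFin n)

  module _ {_⊕_ : Fin n → Fin n → Fin n} {A B : Subset n} where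

    ∈-image₂⁻ : ∀ {x} → x ∈ image₂ _⊕_ A B → ∃[ a ] ∃[ b ] a ∈ A × b ∈ B × x ≡ a ⊕ b
    ∈-image₂⁻ {x} x∈ =
      let a , _ , t       = T-any⁻ _ (allFin n) (∈-tabulate⁻ x∈)
          b , _ , t′      = T-any⁻ _ (allFin n) t
          a∈A , b∈B∧x≡a⊕b = Equivalence.to T-∧ t′
          b∈B , x≡a⊕b     = Equivalence.to T-∧ b∈B∧x≡a⊕b
      in a , b , T-lookup⇒∈ a∈A , T-lookup⇒∈ b∈B , T-does⁻ (x ≟ (a ⊕ b)) x≡a⊕b

    ∈-image₂⁺ : ∀ {a b} → a ∈ A → b ∈ B → a ⊕ b ∈ image₂ _⊕_ A B
    ∈-image₂⁺ {a} {b} a∈A b∈B = ∈-tabulate⁺ (T-any⁺ _ (∈-allFin a) (T-any⁺ _ (∈-allFin b)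
      (Equivalence.from T-∧ (∈⇒T-lookup a∈A ,
        Equivalence.from T-∧ (∈⇒T-lookup b∈B , T-does⁺ ((a ⊕ b) ≟ (a ⊕ b)) refl)))))

-- The packing number

module _ {n : ℕ} (_∙_ : Fin n → Fin n → Fin n) (ε : Fin n) (_⁻¹ : Fin n → Fin n) where

  -- By foldr-selective the maximum defining ν is 0 or one of the values it ranges over; the
  -- ascription lets Agda read that list off the definition of ν.
  ν-elim : ∀ (P : ℕ → Set) (A : Subset n) → P 0 →
           (∀ B → T (isPacking _∙_ ε _⁻¹ A B) → P ∣ B ∣) → P (ν _∙_ ε _⁻¹ A)
  ν-elim P A P0 P-packing
    with (ν _∙_ ε _⁻¹ A ≡ 0 ⊎ ν _∙_ ε _⁻¹ A ∈ₗ map _ (allSubsets n)) ∋ foldr-selective ⊔-sel 0 _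
  ... | inj₁ ν≡0 = subst P (sym ν≡0) P0
  ... | inj₂ ν∈ with ∈-map⁻ _ ν∈
  ... | B , _ , ν≡ with isPacking _∙_ ε _⁻¹ A B in packing
  ... | true  = subst P (sym ν≡) (P-packing B (subst T (sym packing) tt))
  ... | false = subst P (sym ν≡) P0

-- Arithmetic

ceilSqrtAux-spec : ∀ k d fuel → (∀ e → e < d → e * e < k) → k ≤ (d + fuel) * (d + fuel) →
                   let r = ceilSqrtAux k d fuel in k ≤ r * r × (∀ e → e < r → e * e < k)
ceilSqrtAux-spec k d zero       below k≤ = subst (λ r → k ≤ r * r) (+-identityʳ d) k≤ , below
ceilSqrtAux-spec k d (suc fuel) below k≤ with k ≤? d * d
... | yes k≤d² = k≤d² , below
... | no  k≰d² = ceilSqrtAux-spec k (suc d) fuel below′ (subst (λ r → k ≤ r * r) (+-suc d fuel) k≤)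
  where
  below′ : ∀ e → e < suc d → e * e < k
  below′ e e<1+d with m≤n⇒m<n∨m≡n (s≤s⁻¹ e<1+d)
  ... | inj₁ e<d  = below e e<d
  ... | inj₂ refl = ≰⇒> k≰d²

ceilSqrt-spec : ∀ k → 1 ≤ k → k ≤ ceilSqrt k * ceilSqrt k × (∀ e → e < ceilSqrt k → e * e < k)
ceilSqrt-spec k 1≤k = ceilSqrtAux-spec k 0 k (λ _ ()) (m≤m*n k k {{>-nonZero 1≤k}})

2≤k≤d²⇒2≤d : ∀ {k d} → 2 ≤ k → k ≤ d * d → 2 ≤ d
2≤k≤d²⇒2≤d {d = zero}          2≤k k≤0 = contradiction (≤-trans 2≤k k≤0) λ ()
2≤k≤d²⇒2≤d {d = suc zero}      2≤k k≤1 = contradiction (≤-trans 2≤k k≤1) λ { (s≤s ()) }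
2≤k≤d²⇒2≤d {d = suc (suc _)}   _   _   = s≤s (s≤s z≤n)

below-square-decomposition : ∀ d r → r < d * d → ∃[ i ] ∃[ j ] i < d × j < d × r + suc i ≡ suc j * d
below-square-decomposition d@(suc d′) r r<d² = d′ ∸ s , q , s≤s (m∸n≤m d′ s) , m<n*o⇒m/o<n r<d² , (begin
  r + suc (d′ ∸ s)            ≡⟨ cong (_+ suc (d′ ∸ s)) (m≡m%n+[m/n]*n r d) ⟩
  s + q * d + suc (d′ ∸ s)    ≡⟨ cong (_+ suc (d′ ∸ s)) (+-comm s (q * d)) ⟩
  q * d + s + suc (d′ ∸ s)    ≡⟨ +-assoc (q * d) s _ ⟩
  q * d + (s + suc (d′ ∸ s))  ≡⟨ cong (q * d +_) (trans (+-suc s _) (cong suc (m+[n∸m]≡n (s≤s⁻¹ (m%n<n r d))))) ⟩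
  q * d + d                   ≡⟨ +-comm (q * d) d ⟩
  suc q * d                   ∎)
  where
  open ≡-Reasoning
  s q : ℕ
  s = r % d
  q = r / d

private
  2[2+e]+2e≡4[1+e] : ∀ e → 2 * suc (suc e) + 2 * e ≡ 4 * suc e
  2[2+e]+2e≡4[1+e] = solve-∀

  [4e]²≡16e² : ∀ e → 4 * e * (4 * e) ≡ 16 * (e * e)
  [4e]²≡16e² = solve-∀

  m*[16*k]≡16*m*k : ∀ m k → m * (16 * k) ≡ 16 * m * k
  m*[16*k]≡16*m*k = solve-∀

-- d ≥ 2 gives 2d ≤ 4(d − 1), and (d − 1)² < k.
square<16* : ∀ {a k} d → 2 ≤ d → a < 2 * d → (∀ e → e < d → e * e < k) → a * a < 16 * k
square<16* (suc zero) (s≤s ()) _ _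
square<16* {a} {k} (suc (suc e)) _ a<2d below = begin-strict
  a * a                    <⟨ *-mono-< a<4d′ a<4d′ ⟩
  4 * suc e * (4 * suc e)  ≡⟨ [4e]²≡16e² (suc e) ⟩
  16 * (suc e * suc e)     ≤⟨ *-monoʳ-≤ 16 (<⇒≤ (below (suc e) (n<1+n (suc e)))) ⟩
  16 * k                   ∎
  where
  open ≤-Reasoning
  a<4d′ : a < 4 * suc e
  a<4d′ = <-≤-trans a<2d (subst (2 * suc (suc e) ≤_) (2[2+e]+2e≡4[1+e] e) (m≤m+n _ (2 * e)))

-- Finite abelian groups

module FiniteAbelianGroup {n : ℕ} {_∙_ : Fin n → Fin n → Fin n} {ε : Fin n} {_⁻¹ : Fin n → Fin n}
                          (isAbelianGroup : IsAbelianGroup _≡_ _∙_ ε _⁻¹) where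

  G : AbelianGroup 0ℓ 0ℓ
  G = record { Carrier = Fin n ; _≈_ = _≡_ ; _∙_ = _∙_ ; ε = ε ; _⁻¹ = _⁻¹ ; isAbelianGroup = isAbelianGroup }

  open AbelianGroup G using (assoc; identityˡ; identityʳ; group; commutativeSemigroup)
  open Group group using (_//_)
  open import Algebra.Properties.AbelianGroup G using (∙-cancelˡ; ∙-cancelʳ; x≈z//y; inverseʳ-unique; //-rightDividesˡ)
  open import Algebra.Properties.CommutativeSemigroup commutativeSemigroup using (xy∙z≈y∙xz; xy∙z≈xz∙y; xy∙z≈zx∙y)

  infix 25 _^_

  _^_ : Fin n → ℕ → Fin n
  g ^ m = pow _∙_ ε _⁻¹ g m

  ^-homo-+ : ∀ g i j → g ^ (i + j) ≡ g ^ i ∙ g ^ j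
  ^-homo-+ g zero    j = sym (identityˡ (g ^ j))
  ^-homo-+ g (suc i) j = trans (cong (g ∙_) (^-homo-+ g i j)) (sym (assoc g (g ^ i) (g ^ j)))

  ∈-productSet⁻ : ∀ {A B x} → x ∈ productSet _∙_ ε _⁻¹ A B → ∃[ a ] ∃[ b ] a ∈ A × b ∈ B × x ≡ a ∙ b
  ∈-productSet⁻ = ∈-image₂⁻

  ∈-ratioSet⁻ : ∀ {A x} → x ∈ ratioSet _∙_ ε _⁻¹ A → ∃[ a ] ∃[ b ] a ∈ A × b ∈ A × x ≡ a // b
  ∈-ratioSet⁻ = ∈-image₂⁻

  ∈-ratioSet⁺ : ∀ {A a b} → a ∈ A → b ∈ A → a // b ∈ ratioSet _∙_ ε _⁻¹ A
  ∈-ratioSet⁺ = ∈-image₂⁺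

  //-cross : ∀ {x y z w} → x // y ≡ z // w → x ∙ w ≡ z ∙ y
  //-cross {x} {y} {z} {w} x/y≡z/w = begin
    x ∙ w                   ≡⟨ cong (_∙ w) (sym (//-rightDividesˡ y x)) ⟩
    ((x // y) ∙ y) ∙ w      ≡⟨ cong (λ t → (t ∙ y) ∙ w) x/y≡z/w ⟩
    ((z // w) ∙ y) ∙ w      ≡⟨ xy∙z≈xz∙y (z // w) y w ⟩
    ((z // w) ∙ w) ∙ y      ≡⟨ cong (_∙ y) (//-rightDividesˡ w z) ⟩
    z ∙ y                   ∎
    where open ≡-Reasoning

  //-transfer : ∀ {a a′ b b′ h h′} → b ∙ h ≡ b′ ∙ h′ → h // h′ ≡ a // a′ → a ∙ b ≡ a′ ∙ b′
  //-transfer {a} {a′} {b} {b′} {h} {h′} bh≡b′h′ h/h′≡a/a′ = ∙-cancelʳ h′ _ _ (begin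
    (a ∙ b) ∙ h′     ≡⟨ xy∙z≈y∙xz a b h′ ⟩
    b ∙ (a ∙ h′)     ≡⟨ cong (b ∙_) (sym (//-cross h/h′≡a/a′)) ⟩
    b ∙ (h ∙ a′)     ≡⟨ sym (assoc b h a′) ⟩
    (b ∙ h) ∙ a′     ≡⟨ cong (_∙ a′) bh≡b′h′ ⟩
    (b′ ∙ h′) ∙ a′   ≡⟨ xy∙z≈zx∙y b′ h′ a′ ⟩
    (a′ ∙ b′) ∙ h′   ∎)
    where open ≡-Reasoning

  -- |A ∘ B| = |A| |B| forces the |A| |B| products a ∙ b to be distinct.
  packing⇒cancel : ∀ {A B} → T (isPacking _∙_ ε _⁻¹ A B) →
                   ∀ {a a′ b b′} → a ∈ A → a′ ∈ A → b ∈ B → b′ ∈ B → a ∙ b ≡ a′ ∙ b′ → b ≡ b′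
  packing⇒cancel {A} {B} packing {a} {a′} {b} {b′} a∈A a′∈A b∈B b′∈B ab≡a′b′ with b ≟ b′
  ... | yes b≡b′ = b≡b′
  ... | no  b≢b′ = contradiction (≡ᵇ⇒≡ _ _ packing) (<⇒≢ ∣A∘B∣<∣A∣∣B∣)
    where
    pairs : List (Fin n × Fin n)
    pairs = cartesianProduct (elements A) (elements B)

    A∘B⊆products : ∀ {x} → x ∈ productSet _∙_ ε _⁻¹ A B → x ∈ₗ map (uncurry _∙_) pairs
    A∘B⊆products x∈ with a , b , a∈ , b∈ , refl ← ∈-productSet⁻ {A} {B} x∈ =
      ∈-map⁺ (uncurry _∙_) (∈-cartesianProduct⁺ (∈-elements⁺ a∈) (∈-elements⁺ b∈))

    collision : ¬ Unique (map (uncurry _∙_) pairs)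
    collision products! = b≢b′ (cong proj₂ (Unique-map⇒injectiveOn (uncurry _∙_) products!
      (∈-cartesianProduct⁺ (∈-elements⁺ a∈A) (∈-elements⁺ b∈B))
      (∈-cartesianProduct⁺ (∈-elements⁺ a′∈A) (∈-elements⁺ b′∈B)) ab≡a′b′))

    length-products : length (map (uncurry _∙_) pairs) ≡ ∣ A ∣ * ∣ B ∣
    length-products = trans (length-map _ pairs)
      (trans (length-cartesianProduct (elements A) (elements B)) (cong₂ _*_ (length-elements A) (length-elements B)))

    ∣A∘B∣<∣A∣∣B∣ : ∣ productSet _∙_ ε _⁻¹ A B ∣ < ∣ A ∣ * ∣ B ∣
    ∣A∘B∣<∣A∣∣B∣ = <-≤-trans (∣p∣<length A∘B⊆products collision) (≤-reflexive length-products)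

  -- The translates b ∙ hs (b ∈ B) are pairwise disjoint subsets of G of size |hs|.
  packing-bound : ∀ {A B} {hs : List (Fin n)} → T (isPacking _∙_ ε _⁻¹ A B) → Unique hs →
                  (∀ {h h′} → h ∈ₗ hs → h′ ∈ₗ hs → h // h′ ∈ ratioSet _∙_ ε _⁻¹ A) →
                  ∣ B ∣ * length hs ≤ n
  packing-bound {A} {B} {hs} packing hs! hs//hs⊆A//A = begin
    ∣ B ∣ * length hs    ≡⟨ length-translates ⟨
    length translates    ≤⟨ Unique-⊆⇒length≤ translates! (λ {x} _ → ∈-allFin x) ⟩
    length (allFin n)    ≡⟨ length-tabulate _ ⟩
    n                    ∎
    where
    open ≤-Reasoning
    pairs translates : List _
    pairs      = cartesianProduct (elements B) hs
    translates = map (uncurry _∙_) pairs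

    length-translates : length translates ≡ ∣ B ∣ * length hs
    length-translates = trans (length-map _ pairs)
      (trans (length-cartesianProduct (elements B) hs) (cong (_* length hs) (length-elements B)))

    translate-injective : ∀ {p q} → p ∈ₗ pairs → q ∈ₗ pairs → uncurry _∙_ p ≡ uncurry _∙_ q → p ≡ q
    translate-injective {b , h} {b′ , h′} p∈ q∈ bh≡b′h′
      with b∈ , h∈ ← ∈-cartesianProduct⁻ (elements B) hs p∈
         | b′∈ , h′∈ ← ∈-cartesianProduct⁻ (elements B) hs q∈
      with a , a′ , a∈A , a′∈A , h/h′≡a/a′ ← ∈-ratioSet⁻ {A} (hs//hs⊆A//A h∈ h′∈)
      with refl ← packing⇒cancel {A} {B} packing a∈A a′∈A (∈-elements⁻ b∈) (∈-elements⁻ b′∈) (//-transfer bh≡b′h′ h/h′≡a/a′)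
      = cong (b ,_) (∙-cancelˡ b h h′ bh≡b′h′)

    translates! : Unique translates
    translates! = Unique-map⁺ (uncurry _∙_) translate-injective (Unique.cartesianProduct⁺ (Unique-elements B) hs!)

  module Cyclic (g : Fin n) (k : ℕ) {{_ : NonZero k}} (gᵏ≡ε : g ^ k ≡ ε)
                (minimal : ∀ m → 1 ≤ m → m < k → g ^ m ≢ ε) where

    H : Subset n
    H = cyclicSet _∙_ ε _⁻¹ g k

    ^-*k : ∀ q → g ^ (q * k) ≡ ε
    ^-*k zero    = refl
    ^-*k (suc q) = begin
      g ^ (k + q * k)        ≡⟨ ^-homo-+ g k (q * k) ⟩
      g ^ k ∙ g ^ (q * k)    ≡⟨ cong₂ _∙_ gᵏ≡ε (^-*k q) ⟩
      ε ∙ ε                  ≡⟨ identityʳ ε ⟩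
      ε                      ∎
      where open ≡-Reasoning

    ^-%k : ∀ m → g ^ m ≡ g ^ (m % k)
    ^-%k m = begin
      g ^ m                          ≡⟨ cong (g ^_) (m≡m%n+[m/n]*n m k) ⟩
      g ^ (m % k + m / k * k)        ≡⟨ ^-homo-+ g (m % k) (m / k * k) ⟩
      g ^ (m % k) ∙ g ^ (m / k * k)  ≡⟨ cong (g ^ (m % k) ∙_) (^-*k (m / k)) ⟩
      g ^ (m % k) ∙ ε                ≡⟨ identityʳ _ ⟩
      g ^ (m % k)                    ∎
      where open ≡-Reasoning

    ^-⁻¹ : ∀ q → (g ^ q) ⁻¹ ≡ g ^ (q * (k ∸ 1))
    ^-⁻¹ q = sym (inverseʳ-unique (g ^ q) _ (begin
      g ^ q ∙ g ^ (q * (k ∸ 1))  ≡⟨ ^-homo-+ g q _ ⟨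
      g ^ (q + q * (k ∸ 1))      ≡⟨ cong (g ^_) (trans (cong (q *_) (sym (suc-pred k))) (*-suc q (k ∸ 1))) ⟨
      g ^ (q * k)                ≡⟨ ^-*k q ⟩
      ε                          ∎))
      where open ≡-Reasoning

    ^-injective : ∀ {i j} → i < j → j < i + k → g ^ i ≢ g ^ j
    ^-injective {i} {j} i<j j<i+k gⁱ≡gʲ =
      minimal (j ∸ i) (m<n⇒0<n∸m i<j) (m<n+o⇒m∸n<o j i j<i+k) (∙-cancelʳ (g ^ i) _ _ (begin
        g ^ (j ∸ i) ∙ g ^ i  ≡⟨ ^-homo-+ g (j ∸ i) i ⟨
        g ^ (j ∸ i + i)      ≡⟨ cong (g ^_) (m∸n+n≡m (<⇒≤ i<j)) ⟩
        g ^ j                ≡⟨ gⁱ≡gʲ ⟨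
        g ^ i                ≡⟨ identityˡ _ ⟨
        ε ∙ g ^ i            ∎))
      where open ≡-Reasoning

    IsPower : Fin n → Set
    IsPower x = ∃[ m ] x ≡ g ^ m

    //-IsPower : ∀ {x y} → IsPower x → IsPower y → IsPower (x // y)
    //-IsPower (p , refl) (q , refl) = p + q * (k ∸ 1) , trans (cong (g ^ p ∙_) (^-⁻¹ q)) (sym (^-homo-+ g p _))

    ^-suc∈H : ∀ {i} → i < k → g ^ suc i ∈ H
    ^-suc∈H i<k = ∈-tabulate⁺ (T-occurs⁺ (λ i → g ^ suc i) (∈-upTo⁺ i<k) refl)

    ∈H⇒IsPower : ∀ {x} → x ∈ H → IsPower x
    ∈H⇒IsPower x∈H = let i , _ , x≡ = T-occurs⁻ (λ i → g ^ suc i) (upTo k) (∈-tabulate⁻ x∈H) in suc i , x≡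

    IsPower⇒∈H : ∀ {x} → IsPower x → x ∈ H
    IsPower⇒∈H (m , refl) = subst (_∈ H) (sym (^-%k m)) (residue∈H (m % k) (m%n<n m k))
      where
      residue∈H : ∀ r → r < k → g ^ r ∈ H
      residue∈H zero    _     = subst (_∈ H) (trans (cong (g ^_) (suc-pred k)) gᵏ≡ε) (^-suc∈H (≤-reflexive (suc-pred k)))
      residue∈H (suc i) 1+i<k = ^-suc∈H (<-trans (n<1+n i) 1+i<k)

    listH : List (Fin n)
    listH = applyUpTo (λ i → g ^ suc i) k

    Unique-listH : Unique listH
    Unique-listH = Unique.applyUpTo⁺₁ _ k λ i<j j<k → ^-injective (s≤s i<j) (s≤s (<-≤-trans j<k (m≤n+m k _)))

    ∈listH⇒IsPower : ∀ {h} → h ∈ₗ listH → IsPower h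
    ∈listH⇒IsPower h∈ = let i , _ , h≡ = ∈-applyUpTo⁻ _ h∈ in suc i , h≡

    module BabyStepGiantStep (d : ℕ) {{_ : NonZero d}} (k≤d² : k ≤ d * d) where

      A : Subset n
      A = setA _∙_ ε _⁻¹ g d

      babySteps giantSteps : List (Fin n)
      babySteps  = map (λ i → g ^ suc i) (upTo d)
      giantSteps = map (λ j → g ^ (suc j * d)) (upTo d)

      ∈A⇒∈steps : ∀ {x} → x ∈ A → x ∈ₗ babySteps ++ giantSteps
      ∈A⇒∈steps {x} x∈A with Equivalence.to T-∨ (∈-tabulate⁻ x∈A)
      ... | inj₁ t with i , i∈ , refl ← T-occurs⁻ (λ i → g ^ suc i) (upTo d) {x} t = ∈-++⁺ˡ (∈-map⁺ _ i∈)
      ... | inj₂ t with j , j∈ , refl ← T-occurs⁻ (λ j → g ^ (suc j * d)) (upTo d) {x} t = ∈-++⁺ʳ babySteps (∈-map⁺ _ j∈)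

      babyStep∈A : ∀ {i} → i < d → g ^ suc i ∈ A
      babyStep∈A i<d = ∈-tabulate⁺ (Equivalence.from T-∨ (inj₁ (T-occurs⁺ (λ i → g ^ suc i) (∈-upTo⁺ i<d) refl)))

      giantStep∈A : ∀ {j} → j < d → g ^ (suc j * d) ∈ A
      giantStep∈A j<d = ∈-tabulate⁺ (Equivalence.from T-∨ (inj₂ (T-occurs⁺ (λ j → g ^ (suc j * d)) (∈-upTo⁺ j<d) refl)))

      ∈A⇒IsPower : ∀ {x} → x ∈ A → IsPower x
      ∈A⇒IsPower x∈A with ∈-++⁻ babySteps (∈A⇒∈steps x∈A)
      ... | inj₁ x∈ = let i , _ , x≡ = ∈-map⁻ _ x∈ in suc i , x≡
      ... | inj₂ x∈ = let j , _ , x≡ = ∈-map⁻ _ x∈ in suc j * d , x≡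

      -- gᵈ is both the last baby step and the first giant step.
      ∣A∣<2d : ∣ A ∣ < 2 * d
      ∣A∣<2d = <-≤-trans (∣p∣<length ∈A⇒∈steps gᵈ-twice) (≤-reflexive length-steps)
        where
        gᵈ-twice : ¬ Unique (babySteps ++ giantSteps)
        gᵈ-twice steps! = Unique-++⇒disjoint babySteps steps!
          (subst (_∈ₗ babySteps) (cong (g ^_) (suc-pred d)) (∈-map⁺ _ (∈-upTo⁺ (≤-reflexive (suc-pred d)))))
          (subst (_∈ₗ giantSteps) (cong (g ^_) (*-identityˡ d)) (∈-map⁺ _ (∈-upTo⁺ (>-nonZero⁻¹ d))))

        length-steps : length (babySteps ++ giantSteps) ≡ 2 * d
        length-steps = begin
          length (babySteps ++ giantSteps)     ≡⟨ length-++ babySteps ⟩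
          length babySteps + length giantSteps ≡⟨ cong₂ _+_ (lengthSteps _) (lengthSteps _) ⟩
          d + d                                ≡⟨ cong (d +_) (+-identityʳ d) ⟨
          2 * d                                ∎
          where
          open ≡-Reasoning
          lengthSteps : ∀ (f : ℕ → Fin n) → length (map f (upTo d)) ≡ d
          lengthSteps f = trans (length-map f (upTo d)) (length-upTo d)

      -- Every r < k ≤ d² is a giant step minus a baby step.
      IsPower⇒∈A//A : ∀ {x} → IsPower x → x ∈ ratioSet _∙_ ε _⁻¹ A
      IsPower⇒∈A//A (m , refl) = subst (_∈ ratioSet _∙_ ε _⁻¹ A) (sym (^-%k m)) (residue∈A//A (m % k) (m%n<n m k))
        where
        residue∈A//A : ∀ r → r < k → g ^ r ∈ ratioSet _∙_ ε _⁻¹ A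
        residue∈A//A r r<k with i , j , i<d , j<d , r+1+i≡[1+j]d ← below-square-decomposition d r (<-≤-trans r<k k≤d²) =
          subst (_∈ ratioSet _∙_ ε _⁻¹ A)
            (sym (x≈z//y _ _ _ (trans (sym (^-homo-+ g r (suc i))) (cong (g ^_) r+1+i≡[1+j]d))))
            (∈-ratioSet⁺ {A} (giantStep∈A j<d) (babyStep∈A i<d))

      ratioSet-A≡H : ratioSet _∙_ ε _⁻¹ A ≡ H
      ratioSet-A≡H = ⊆-antisym A//A⊆H (IsPower⇒∈A//A ∘ ∈H⇒IsPower)
        where
        A//A⊆H : ∀ {x} → x ∈ ratioSet _∙_ ε _⁻¹ A → x ∈ H
        A//A⊆H x∈ with a , b , a∈A , b∈A , refl ← ∈-ratioSet⁻ {A} x∈ =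
          IsPower⇒∈H (//-IsPower (∈A⇒IsPower a∈A) (∈A⇒IsPower b∈A))

      ν[A]*k≤n : ν _∙_ ε _⁻¹ A * k ≤ n
      ν[A]*k≤n = ν-elim _∙_ ε _⁻¹ (λ m → m * k ≤ n) A z≤n λ B packing →
        subst (λ l → ∣ B ∣ * l ≤ n) (length-applyUpTo (λ i → g ^ suc i) k)
          (packing-bound {A} {B} packing Unique-listH λ h∈ h′∈ →
            IsPower⇒∈A//A (//-IsPower (∈listH⇒IsPower h∈) (∈listH⇒IsPower h′∈)))

mainTheorem1 : (n : ℕ) (_∙_ : Fin n → Fin n → Fin n) (ε : Fin n) (_⁻¹ : Fin n → Fin n) →
    IsAbelianGroup _≡_ _∙_ ε _⁻¹ →
    (g : Fin n) (k : ℕ) → 2 ≤ k →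
    pow _∙_ ε _⁻¹ g k ≡ ε →
    (∀ m → 1 ≤ m → m < k → pow _∙_ ε _⁻¹ g m ≢ ε) →
    let d = ceilSqrt k
        A = setA _∙_ ε _⁻¹ g d
        H = cyclicSet _∙_ ε _⁻¹ g k
    in (∣ A ∣ < 2 * d)
       × (ratioSet _∙_ ε _⁻¹ A ≡ H)
       × (ν _∙_ ε _⁻¹ A * k ≤ n)
       × (n * (∣ A ∣ * ∣ A ∣) < 16 * n * k)
mainTheorem1 zero      _   ()  _   _              _ _ _   _    _
mainTheorem1 n@(suc _) _∙_ ε _⁻¹ isAbelianGroup g k 2≤k gᵏ≡ε minimal =
  ∣A∣<2d , ratioSet-A≡H , ν[A]*k≤n ,
  subst (n * (∣ A ∣ * ∣ A ∣) <_) (m*[16*k]≡16*m*k n k) (*-monoʳ-< n (square<16* d 2≤d ∣A∣<2d below-d))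
  where
  d : ℕ
  d = ceilSqrt k
  1≤k : 1 ≤ k
  1≤k = ≤-trans (s≤s z≤n) 2≤k
  k≤d² : k ≤ d * d
  k≤d² = proj₁ (ceilSqrt-spec k 1≤k)
  below-d : ∀ e → e < d → e * e < k
  below-d = proj₂ (ceilSqrt-spec k 1≤k)
  2≤d : 2 ≤ d
  2≤d = 2≤k≤d²⇒2≤d 2≤k k≤d²
  instance
    k≢0 : NonZero k
    k≢0 = >-nonZero 1≤k
    d≢0 : NonZero d
    d≢0 = >-nonZero (≤-trans (s≤s z≤n) 2≤d)
  open FiniteAbelianGroup isAbelianGroup
  open Cyclic g k gᵏ≡ε minimal
  open BabyStepGiantStep d k≤d²
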